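{- Let $D$ be a finite simple digraph of order $n \geq 3$. Then $\gamma_I(D)=2$ if and only if either $\Delta^+(D)=n-1$, or there exist two distinct vertices $u$ and $v$ of $D$ such that $V(D)\setminus\{u,v\}\subseteq N_D^+(u)$ and $V(D)\setminus\{u,v\}\subseteq N_D^+(v)$.
   Context: A finite simple digraph has no loops and no multiple arcs (oppositely oriented arcs allowed). $N_D^+(v)$ is the set of out-neighbors of $v$ and $\Delta^+(D)$ the maximum out-degree. An Italian dominating function (IDF) on $D$ is a function $f:V(D)\to\{0,1,2\}$ such that every vertex $v$ with $f(v)=0$ has at least two in-neighbors $w$ with $f(w)=1$ or at least one in-neighbor $w$ with $f(w)=2$. Its weight is $\sum_{u\in V(D)}f(u)$, and $\gamma_I(D)$ is the minimum weight of an IDF on $D$. -}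

module Defs where

open import Level using (0ℓ)
open import Data.Nat using (ℕ; zero; suc; _+_; _⊔_; _≤_)
open import Data.Fin using (Fin)
open import Data.List using (List; allFin; map; foldr; filter; length)
open import Data.Nat.ListAction using (sum)
open import Data.Sum using (_⊎_)
open import Data.Product using (Σ; _×_; _,_)
open import Relation.Nullary using (¬_; Dec)
open import Relation.Binary.PropositionalEquality using (_≡_; _≢_)

-- Multiple arcs are impossible
-- by construction (a relation); oppositely oriented arcs are allowed.
record Digraph (n : ℕ) : Set₁ where
  field
    Arc   : Fin n → Fin n → Set
    Arc?  : ∀ u v → Dec (Arc u v)
    loopless : ∀ v → ¬ Arc v v
open Digraph public

outdeg : ∀ {n} → Digraph n → Fin n → ℕ
outdeg {n} D v = length (filter (Arc? D v) (allFin n))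

Δ⁺ : ∀ {n} → Digraph n → ℕ
Δ⁺ {n} D = foldr _⊔_ 0 (map (outdeg D) (allFin n))

data Val : Set where
  v0 v1 v2 : Val

val : Val → ℕ
val v0 = 0
val v1 = 1
val v2 = 2

IsIDF : ∀ {n} → Digraph n → (Fin n → Val) → Set
IsIDF {n} D f = ∀ v → f v ≡ v0 →
    (Σ (Fin n) λ w → Arc D w v × f w ≡ v2)
  ⊎ (Σ (Fin n) λ w → Σ (Fin n) λ w' → w ≢ w' × Arc D w v × Arc D w' v × f w ≡ v1 × f w' ≡ v1)

weight : ∀ {n} → (Fin n → Val) → ℕ
weight {n} f = sum (map (λ u → val (f u)) (allFin n))

γI≡ : ∀ {n} → Digraph n → ℕ → Set
γI≡ D k = (Σ _ λ f → IsIDF D f × weight f ≡ k) × (∀ f → IsIDF D f → k ≤ weight f)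

-- The lower bound γ_I ≥ 2 holds once n ≥ 2: a vertex of value 0 has in-neighbours of total
-- value at least 2, and otherwise every vertex contributes at least 1.  Conversely, take an
-- IDF f of weight 2.  Since n ≥ 3 it has a vertex of value 0, so f is either 2 on a single
-- vertex u or 1 on two vertices u, v, and 0 elsewhere; then every other vertex has value 0
-- and can only be defended by u (which therefore has out-degree n - 1), respectively by
-- both u and v.  The two dominating configurations give IDFs of weight 2 back.
module Submission where

open import Defs
open import Data.Bool using (true; false; if_then_else_; _∨_)
open import Data.Bool.Properties using (∨-zeroʳ)
open import Data.Fin using (Fin; zero; suc; punchIn; punchOut; _≟_)
open import Data.Fin.Properties
  using (any?; punchIn-punchOut; punchOut-punchIn; punchInᵢ≢i; punchOut-injective; punchOut-cong)
open import Data.List using (map; filter; length; tabulate; allFin)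
open import Data.List.Membership.Propositional.Properties using (∈-allFin; ∈-map⁺; ∈-map⁻; foldr-selective)
open import Data.List.Properties using (foldr-preservesᵇ; foldr-preservesᵒ)
open import Data.List.Relation.Unary.All.Properties using (map⁺; tabulate⁺)
import Data.List.Relation.Unary.Any as Any
open import Data.Nat using (ℕ; zero; suc; _+_; _∸_; _≤_; _⊔_; z≤n)
open import Data.Nat.Properties renaming (_≟_ to _≟ℕ_)
import Data.Nat.ListAction as ListAction
open import Algebra.Properties.CommutativeMonoid.Sum +-0-commutativeMonoid
  using (sum; sum-cong-≗; sum-replicate-zero; sum-remove; ∑-distrib-+)
open import Data.Product using (Σ; _×_; _,_; proj₁; proj₂)
open import Data.Sum using (_⊎_; inj₁; inj₂; [_,_]; [_,_]′)
import Data.Sum as Sum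
open import Function using (_∘_; id)
open import Function.Bundles using (_⇔_; mk⇔; Equivalence)
open import Relation.Binary.PropositionalEquality
  using (_≡_; _≢_; refl; sym; trans; cong; cong₂; subst; subst₂; module ≡-Reasoning)
open import Relation.Nullary using (¬_; Dec; yes; no; does; ¬?; contradiction)
open import Relation.Nullary.Decidable using (decidable-stable; dec-true; dec-false)
open import Relation.Unary using (Pred; Decidable)

open Equivalence using (to; from)

sum≡0⇒≗0 : ∀ {n} (g : Fin n → ℕ) → sum g ≡ 0 → ∀ i → g i ≡ 0
sum≡0⇒≗0 g eq zero    = m+n≡0⇒m≡0 (g zero) eq
sum≡0⇒≗0 g eq (suc i) = sum≡0⇒≗0 (g ∘ suc) (m+n≡0⇒n≡0 (g zero) eq) i

≗0⇒sum≡0 : ∀ {n} (g : Fin n → ℕ) → (∀ i → g i ≡ 0) → sum g ≡ 0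
≗0⇒sum≡0 {n} g g≗0 = trans (sum-cong-≗ g≗0) (sum-replicate-zero n)

sum-const-1 : ∀ n → sum {n} (λ _ → 1) ≡ n
sum-const-1 zero    = refl
sum-const-1 (suc n) = cong suc (sum-const-1 n)

n≤sum : ∀ {n} (g : Fin n → ℕ) → (∀ i → 1 ≤ g i) → n ≤ sum g
n≤sum {zero}  g 1≤g = z≤n
n≤sum {suc n} g 1≤g = +-mono-≤ (1≤g zero) (n≤sum (g ∘ suc) (1≤g ∘ suc))

≤sum : ∀ {n} (g : Fin n → ℕ) i → g i ≤ sum g
≤sum {suc n} g i = subst (g i ≤_) (sym (sum-remove {i = i} g)) (m≤m+n (g i) _)

+≤sum : ∀ {n} (g : Fin n → ℕ) {i j} → i ≢ j → g i + g j ≤ sum g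
+≤sum {suc n} g {i} {j} i≢j = subst (g i + g j ≤_) (sym (sum-remove {i = i} g))
  (+-monoʳ-≤ (g i) (≤-trans (≤-reflexive (cong g (sym (punchIn-punchOut i≢j))))
                              (≤sum (g ∘ punchIn i) (punchOut i≢j))))

sum≡at⇔0-off : ∀ {n} (g : Fin n → ℕ) i → sum g ≡ g i ⇔ (∀ j → j ≢ i → g j ≡ 0)
sum≡at⇔0-off {suc n} g i = mk⇔ 0-off sum≡at
  where
  open ≡-Reasoning
  rest : sum g ≡ g i + sum (g ∘ punchIn i)
  rest = sum-remove {i = i} g
  0-off : sum g ≡ g i → ∀ j → j ≢ i → g j ≡ 0
  0-off eq j j≢i = begin
    g j                                  ≡⟨ cong g (punchIn-punchOut (j≢i ∘ sym)) ⟨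
    g (punchIn i (punchOut (j≢i ∘ sym))) ≡⟨ sum≡0⇒≗0 (g ∘ punchIn i) rest≡0 _ ⟩
    0                                    ∎
    where
    rest≡0 : sum (g ∘ punchIn i) ≡ 0
    rest≡0 = +-cancelˡ-≡ (g i) _ 0 (trans (sym rest) (trans eq (sym (+-identityʳ (g i)))))
  sum≡at : (∀ j → j ≢ i → g j ≡ 0) → sum g ≡ g i
  sum≡at off = begin
    sum g                      ≡⟨ rest ⟩
    g i + sum (g ∘ punchIn i)  ≡⟨ cong (g i +_) (≗0⇒sum≡0 _ (λ j → off _ (punchInᵢ≢i i j))) ⟩
    g i + 0                    ≡⟨ +-identityʳ (g i) ⟩
    g i                        ∎

-- Removing i turns the two-point statement about g into the one-point statement about
-- g ∘ punchIn i at the position punchOut i≢j of j.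
sum≡at₂⇔0-off₂ : ∀ {n} (g : Fin n → ℕ) {i j} → i ≢ j →
                  sum g ≡ g i + g j ⇔ (∀ k → k ≢ i → k ≢ j → g k ≡ 0)
sum≡at₂⇔0-off₂ {suc n} g {i} {j} i≢j = mk⇔ 0-off₂ sum≡at₂
  where
  open ≡-Reasoning
  h : Fin n → ℕ
  h = g ∘ punchIn i
  l : Fin n
  l = punchOut i≢j
  h[l]≡g[j] : h l ≡ g j
  h[l]≡g[j] = cong g (punchIn-punchOut i≢j)
  rest : sum g ≡ g i + sum h
  rest = sum-remove {i = i} g
  0-off₂ : sum g ≡ g i + g j → ∀ k → k ≢ i → k ≢ j → g k ≡ 0
  0-off₂ eq k k≢i k≢j = begin
    g k                       ≡⟨ cong g (punchIn-punchOut (k≢i ∘ sym)) ⟨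
    h (punchOut (k≢i ∘ sym))  ≡⟨ to (sum≡at⇔0-off h l) sum-h≡h[l] _ punchOut≢l ⟩
    0                         ∎
    where
    sum-h≡h[l] : sum h ≡ h l
    sum-h≡h[l] = +-cancelˡ-≡ (g i) _ _ (trans (sym rest) (trans eq (cong (g i +_) (sym h[l]≡g[j]))))
    punchOut≢l : punchOut (k≢i ∘ sym) ≢ l
    punchOut≢l = k≢j ∘ punchOut-injective (k≢i ∘ sym) i≢j
  sum≡at₂ : (∀ k → k ≢ i → k ≢ j → g k ≡ 0) → sum g ≡ g i + g j
  sum≡at₂ off = begin
    sum g        ≡⟨ rest ⟩
    g i + sum h  ≡⟨ cong (g i +_) (from (sum≡at⇔0-off h l) h-off) ⟩
    g i + h l    ≡⟨ cong (g i +_) h[l]≡g[j] ⟩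
    g i + g j    ∎
    where
    h-off : ∀ m → m ≢ l → h m ≡ 0
    h-off m m≢l = off _ (punchInᵢ≢i i m)
      (λ e → m≢l (trans (sym (punchOut-punchIn i)) (punchOut-cong i e)))

sum-map-tabulate : ∀ {a n} {A : Set a} (g : A → ℕ) (h : Fin n → A) →
                   ListAction.sum (map g (tabulate h)) ≡ sum (g ∘ h)
sum-map-tabulate {n = zero}  g h = refl
sum-map-tabulate {n = suc n} g h = cong (g (h zero) +_) (sum-map-tabulate g (h ∘ suc))

indicator : ∀ {a} {A : Set a} → Dec A → ℕ
indicator d = if does d then 1 else 0

indicator-yes : ∀ {a} {A : Set a} (d : Dec A) → A → indicator d ≡ 1
indicator-yes (yes _) _ = refl
indicator-yes (no ¬a) a = contradiction a ¬a

indicator-no : ∀ {a} {A : Set a} (d : Dec A) → ¬ A → indicator d ≡ 0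
indicator-no (yes a) ¬a = contradiction a ¬a
indicator-no (no _)  _  = refl

indicator≡0⇒¬ : ∀ {a} {A : Set a} (d : Dec A) → indicator d ≡ 0 → ¬ A
indicator≡0⇒¬ (no ¬a) _ = ¬a

indicator+indicator¬≡1 : ∀ {a} {A : Set a} (d : Dec A) → indicator d + indicator (¬? d) ≡ 1
indicator+indicator¬≡1 (yes _) = refl
indicator+indicator¬≡1 (no _)  = refl

length-filter-tabulate : ∀ {a p n} {A : Set a} {P : Pred A p} (P? : Decidable P) (h : Fin n → A) →
                         length (filter P? (tabulate h)) ≡ sum (λ i → indicator (P? (h i)))
length-filter-tabulate {n = zero}  P? h = refl
length-filter-tabulate {n = suc n} P? h with does (P? (h zero))
... | true  = cong suc (length-filter-tabulate P? (h ∘ suc))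
... | false = length-filter-tabulate P? (h ∘ suc)

count : ∀ {n p} {P : Pred (Fin n) p} → Decidable P → ℕ
count P? = sum (λ i → indicator (P? i))

count+count¬≡n : ∀ {n p} {P : Pred (Fin n) p} (P? : Decidable P) → count P? + count (¬? ∘ P?) ≡ n
count+count¬≡n {n} P? = begin
  count P? + count (¬? ∘ P?)                            ≡⟨ ∑-distrib-+ (indicator ∘ P?) (indicator ∘ ¬? ∘ P?) ⟨
  sum (λ i → indicator (P? i) + indicator (¬? (P? i)))  ≡⟨ sum-cong-≗ (indicator+indicator¬≡1 ∘ P?) ⟩
  sum {n} (λ _ → 1)                                     ≡⟨ sum-const-1 n ⟩
  n                                                     ∎
  where open ≡-Reasoning

module _ {n p} {P : Pred (Fin n) p} (P? : Decidable P) {v : Fin n} (¬Pv : ¬ P v) where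

  private
    count¬ : ℕ
    count¬ = count (¬? ∘ P?)

    count≡n∸count¬ : count P? ≡ n ∸ count¬
    count≡n∸count¬ = trans (sym (m+n∸n≡m _ count¬)) (cong (_∸ count¬) (count+count¬≡n P?))

    count¬≤n : count¬ ≤ n
    count¬≤n = subst (count¬ ≤_) (count+count¬≡n P?) (m≤n+m count¬ (count P?))

    indicator¬[v]≡1 : indicator (¬? (P? v)) ≡ 1
    indicator¬[v]≡1 = indicator-yes (¬? (P? v)) ¬Pv

    1≤count¬ : 1 ≤ count¬
    1≤count¬ = subst (_≤ count¬) indicator¬[v]≡1 (≤sum _ v)

    count¬≡1⇔ : count¬ ≡ 1 ⇔ (∀ w → w ≢ v → P w)
    count¬≡1⇔ = mk⇔
      (λ eq w w≢v → decidable-stable (P? w) (indicator≡0⇒¬ (¬? (P? w))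
         (to (sum≡at⇔0-off _ v) (trans eq (sym indicator¬[v]≡1)) w w≢v)))
      (λ all → trans (from (sum≡at⇔0-off _ v)
         (λ w w≢v → indicator-no (¬? (P? w)) (λ ¬Pw → ¬Pw (all w w≢v)))) indicator¬[v]≡1)

  count≤n∸1 : count P? ≤ n ∸ 1
  count≤n∸1 = subst (_≤ n ∸ 1) (sym count≡n∸count¬) (∸-monoʳ-≤ n 1≤count¬)

  count≡n∸1⇔ : count P? ≡ n ∸ 1 ⇔ (∀ w → w ≢ v → P w)
  count≡n∸1⇔ = mk⇔
    (λ eq → to count¬≡1⇔
       (∸-cancelˡ-≡ count¬≤n (≤-trans 1≤count¬ count¬≤n) (trans (sym count≡n∸count¬) eq)))
    (λ all → trans count≡n∸count¬ (cong (n ∸_) (from count¬≡1⇔ all)))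

DominatingVertex : ∀ {n} → Digraph n → Set
DominatingVertex {n} D = Σ (Fin n) λ u → ∀ w → w ≢ u → Arc D u w

DominatingPair : ∀ {n} → Digraph n → Set
DominatingPair {n} D =
  Σ (Fin n) λ u → Σ (Fin n) λ v → u ≢ v × (∀ w → w ≢ u → w ≢ v → Arc D u w × Arc D v w)

module _ {n} (D : Digraph n) where

  outdeg≡count : ∀ v → outdeg D v ≡ count (Arc? D v)
  outdeg≡count v = length-filter-tabulate (Arc? D v) id

  outdeg≤n∸1 : ∀ v → outdeg D v ≤ n ∸ 1
  outdeg≤n∸1 v = subst (_≤ n ∸ 1) (sym (outdeg≡count v)) (count≤n∸1 (Arc? D v) (loopless D v))

  outdeg≡n∸1⇔ : ∀ v → outdeg D v ≡ n ∸ 1 ⇔ (∀ w → w ≢ v → Arc D v w)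
  outdeg≡n∸1⇔ v = subst (λ d → d ≡ n ∸ 1 ⇔ (∀ w → w ≢ v → Arc D v w)) (sym (outdeg≡count v))
    (count≡n∸1⇔ (Arc? D v) (loopless D v))

  outdeg≤Δ⁺ : ∀ v → outdeg D v ≤ Δ⁺ D
  outdeg≤Δ⁺ v = foldr-preservesᵒ {P = outdeg D v ≤_} ⊔-preserves 0 _
    (inj₂ (Any.map ≤-reflexive (∈-map⁺ (outdeg D) (∈-allFin v))))
    where
    ⊔-preserves : ∀ x y → outdeg D v ≤ x ⊎ outdeg D v ≤ y → outdeg D v ≤ x ⊔ y
    ⊔-preserves x y = [ (λ p → ≤-trans p (m≤m⊔n x y)) , (λ p → ≤-trans p (m≤n⊔m x y)) ]

  Δ⁺≤n∸1 : Δ⁺ D ≤ n ∸ 1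
  Δ⁺≤n∸1 = foldr-preservesᵇ {P = _≤ n ∸ 1} ⊔-lub z≤n (map⁺ (tabulate⁺ outdeg≤n∸1))

  Δ⁺-attained : Δ⁺ D ≡ 0 ⊎ Σ (Fin n) λ v → Δ⁺ D ≡ outdeg D v
  Δ⁺-attained with foldr-selective ⊔-sel 0 (map (outdeg D) (allFin n))
  ... | inj₁ Δ⁺≡0 = inj₁ Δ⁺≡0
  ... | inj₂ Δ⁺∈ with ∈-map⁻ (outdeg D) Δ⁺∈
  ...   | v , _ , Δ⁺≡outdeg = inj₂ (v , Δ⁺≡outdeg)

  Δ⁺≡n∸1⇔ : 2 ≤ n → Δ⁺ D ≡ n ∸ 1 ⇔ DominatingVertex D
  Δ⁺≡n∸1⇔ 2≤n = mk⇔ attained dominating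
    where
    attained : Δ⁺ D ≡ n ∸ 1 → DominatingVertex D
    attained Δ⁺≡n∸1 with Δ⁺-attained
    ... | inj₁ Δ⁺≡0 = contradiction (trans (sym Δ⁺≡n∸1) Δ⁺≡0) (m>n⇒m∸n≢0 2≤n)
    ... | inj₂ (v , Δ⁺≡outdeg) = v , to (outdeg≡n∸1⇔ v) (trans (sym Δ⁺≡outdeg) Δ⁺≡n∸1)
    dominating : DominatingVertex D → Δ⁺ D ≡ n ∸ 1
    dominating (v , dom) = ≤-antisym Δ⁺≤n∸1
      (subst (_≤ Δ⁺ D) (from (outdeg≡n∸1⇔ v) dom) (outdeg≤Δ⁺ v))

val≡0⇒v0 : ∀ {p} → val p ≡ 0 → p ≡ v0
val≡0⇒v0 {v0} _ = refl

≡v1⇒≢v0 : ∀ {p} → p ≡ v1 → p ≢ v0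
≡v1⇒≢v0 refl ()

≡v2⇒≢v0 : ∀ {p} → p ≡ v2 → p ≢ v0
≡v2⇒≢v0 refl ()

v2≢v1 : v2 ≢ v1
v2≢v1 ()

weight≡sum : ∀ {n} (f : Fin n → Val) → weight f ≡ sum (val ∘ f)
weight≡sum f = sum-map-tabulate (val ∘ f) id

v0-or-n≤weight : ∀ {n} (f : Fin n → Val) → (Σ (Fin n) λ z → f z ≡ v0) ⊎ n ≤ weight f
v0-or-n≤weight f with any? (λ x → val (f x) ≟ℕ 0)
... | yes (z , val≡0) = inj₁ (z , val≡0⇒v0 val≡0)
... | no ∄z = inj₂ (subst (_ ≤_) (sym (weight≡sum f))
  (n≤sum (val ∘ f) (λ x → n≢0⇒n>0 (λ val≡0 → ∄z (x , val≡0)))))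

module _ {a} {A : Set a} {n} (g : Fin n → A) {z : A} where

  ≢-off⇒≡ : ∀ {u} → (∀ x → x ≢ u → g x ≡ z) → ∀ {y} → g y ≢ z → y ≡ u
  ≢-off⇒≡ {u} off {y} gy≢z = decidable-stable (y ≟ u) (gy≢z ∘ off y)

  ≢-off₂⇒≡⊎≡ : ∀ {u v} → (∀ x → x ≢ u → x ≢ v → g x ≡ z) → ∀ {y} → g y ≢ z → y ≡ u ⊎ y ≡ v
  ≢-off₂⇒≡⊎≡ {u} {v} off {y} gy≢z with y ≟ u
  ... | yes y≡u = inj₁ y≡u
  ... | no  y≢u = inj₂ (decidable-stable (y ≟ v) (gy≢z ∘ off y y≢u))

module _ {n} (D : Digraph n) {f : Fin n → Val} (idf : IsIDF D f) where

  v0⇒2≤weight : ∀ {z} → f z ≡ v0 → 2 ≤ weight f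
  v0⇒2≤weight {z} fz≡v0 with idf z fz≡v0
  ... | inj₁ (w , _ , fw≡v2) =
    subst₂ _≤_ (cong val fw≡v2) (sym (weight≡sum f)) (≤sum (val ∘ f) w)
  ... | inj₂ (w , w′ , w≢w′ , _ , _ , fw≡v1 , fw′≡v1) =
    subst₂ _≤_ (cong₂ _+_ (cong val fw≡v1) (cong val fw′≡v1)) (sym (weight≡sum f)) (+≤sum (val ∘ f) w≢w′)

  2≤weight : 2 ≤ n → 2 ≤ weight f
  2≤weight 2≤n = [ (λ (_ , fz≡v0) → v0⇒2≤weight fz≡v0) , ≤-trans 2≤n ]′ (v0-or-n≤weight f)

  -- With only one nonzero vertex, no vertex has two in-neighbours of value 1.
  supported-at⇒dominating : ∀ {u} → (∀ x → x ≢ u → f x ≡ v0) → ∀ x → x ≢ u → Arc D u x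
  supported-at⇒dominating off x x≢u with idf x (off x x≢u)
  ... | inj₁ (y , y→x , fy≡v2) = subst (λ y → Arc D y x) (≢-off⇒≡ f off (≡v2⇒≢v0 fy≡v2)) y→x
  ... | inj₂ (a , a′ , a≢a′ , _ , _ , fa≡v1 , fa′≡v1) =
    contradiction (trans (≢-off⇒≡ f off (≡v1⇒≢v0 fa≡v1)) (sym (≢-off⇒≡ f off (≡v1⇒≢v0 fa′≡v1))))
                  a≢a′

  supported-on₂⇒dominating : ∀ {u v} → f u ≡ v1 → f v ≡ v1 → (∀ x → x ≢ u → x ≢ v → f x ≡ v0) →
                             ∀ x → x ≢ u → x ≢ v → Arc D u x × Arc D v x
  supported-on₂⇒dominating fu≡v1 fv≡v1 off x x≢u x≢v with idf x (off x x≢u x≢v)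
  ... | inj₁ (y , _ , fy≡v2) with ≢-off₂⇒≡⊎≡ f off (≡v2⇒≢v0 fy≡v2)
  ...   | inj₁ refl = contradiction (trans (sym fy≡v2) fu≡v1) v2≢v1
  ...   | inj₂ refl = contradiction (trans (sym fy≡v2) fv≡v1) v2≢v1
  supported-on₂⇒dominating fu≡v1 fv≡v1 off x x≢u x≢v
    | inj₂ (a , a′ , a≢a′ , a→x , a′→x , fa≡v1 , fa′≡v1)
    with ≢-off₂⇒≡⊎≡ f off (≡v1⇒≢v0 fa≡v1) | ≢-off₂⇒≡⊎≡ f off (≡v1⇒≢v0 fa′≡v1)
  ... | inj₁ refl | inj₁ refl = contradiction refl a≢a′
  ... | inj₁ refl | inj₂ refl = a→x , a′→x
  ... | inj₂ refl | inj₁ refl = a′→x , a→x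
  ... | inj₂ refl | inj₂ refl = contradiction refl a≢a′

  weight≡2⇒dominating : 3 ≤ n → weight f ≡ 2 → DominatingVertex D ⊎ DominatingPair D
  weight≡2⇒dominating 3≤n weight≡2 with v0-or-n≤weight f
  ... | inj₂ n≤weight = contradiction (≤-trans 3≤n (≤-trans n≤weight (≤-reflexive weight≡2))) (n≮n 2)
  ... | inj₁ (z , fz≡v0) with idf z fz≡v0
  ...   | inj₁ (u , _ , fu≡v2) = inj₁ (u , supported-at⇒dominating
            (λ x x≢u → val≡0⇒v0 (to (sum≡at⇔0-off (val ∘ f) u) sum≡val[fu] x x≢u)))
    where
    sum≡val[fu] : sum (val ∘ f) ≡ val (f u)
    sum≡val[fu] = trans (sym (weight≡sum f)) (trans weight≡2 (cong val (sym fu≡v2)))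
  ...   | inj₂ (u , v , u≢v , _ , _ , fu≡v1 , fv≡v1) =
    inj₂ (u , v , u≢v , supported-on₂⇒dominating fu≡v1 fv≡v1
            (λ x x≢u x≢v → val≡0⇒v0 (to (sum≡at₂⇔0-off₂ (val ∘ f) u≢v) sum≡val[fu]+val[fv] x x≢u x≢v)))
    where
    sum≡val[fu]+val[fv] : sum (val ∘ f) ≡ val (f u) + val (f v)
    sum≡val[fu]+val[fv] =
      trans (sym (weight≡sum f)) (trans weight≡2 (cong₂ _+_ (cong val (sym fu≡v1)) (cong val (sym fv≡v1))))

point₂ : ∀ {n} → Fin n → Fin n → Val
point₂ u x = if does (x ≟ u) then v2 else v0

pair₁ : ∀ {n} → Fin n → Fin n → Fin n → Val
pair₁ u v x = if does (x ≟ u) ∨ does (x ≟ v) then v1 else v0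

module _ {n} {u : Fin n} where

  point₂-at : point₂ u u ≡ v2
  point₂-at = cong (if_then v2 else v0) (dec-true (u ≟ u) refl)

  point₂-off : ∀ {x} → x ≢ u → point₂ u x ≡ v0
  point₂-off x≢u = cong (if_then v2 else v0) (dec-false (_ ≟ u) x≢u)

  weight-point₂ : weight (point₂ u) ≡ 2
  weight-point₂ = trans (weight≡sum (point₂ u))
    (trans (from (sum≡at⇔0-off (val ∘ point₂ u) u) (λ x x≢u → cong val (point₂-off x≢u)))
           (cong val point₂-at))

  module _ (D : Digraph n) where

    dominating⇒point₂-IDF : (∀ w → w ≢ u → Arc D u w) → IsIDF D (point₂ u)
    dominating⇒point₂-IDF dom x fx≡v0 = inj₁ (u , dom x x≢u , point₂-at)
      where
      x≢u : x ≢ u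
      x≢u refl = ≡v2⇒≢v0 point₂-at fx≡v0

module _ {n} {u v : Fin n} where

  pair₁-at₁ : pair₁ u v u ≡ v1
  pair₁-at₁ = cong (λ b → if b ∨ does (u ≟ v) then v1 else v0) (dec-true (u ≟ u) refl)

  pair₁-at₂ : pair₁ u v v ≡ v1
  pair₁-at₂ = cong (if_then v1 else v0)
    (trans (cong (does (v ≟ u) ∨_) (dec-true (v ≟ v) refl)) (∨-zeroʳ (does (v ≟ u))))

  pair₁-off : ∀ {x} → x ≢ u → x ≢ v → pair₁ u v x ≡ v0
  pair₁-off {x} x≢u x≢v =
    cong (if_then v1 else v0) (cong₂ _∨_ (dec-false (x ≟ u) x≢u) (dec-false (x ≟ v) x≢v))

  weight-pair₁ : u ≢ v → weight (pair₁ u v) ≡ 2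
  weight-pair₁ u≢v = trans (weight≡sum (pair₁ u v))
    (trans (from (sum≡at₂⇔0-off₂ (val ∘ pair₁ u v) u≢v) (λ x x≢u x≢v → cong val (pair₁-off x≢u x≢v)))
           (cong₂ _+_ (cong val pair₁-at₁) (cong val pair₁-at₂)))

  module _ (D : Digraph n) where

    dominating⇒pair₁-IDF : u ≢ v → (∀ w → w ≢ u → w ≢ v → Arc D u w × Arc D v w) → IsIDF D (pair₁ u v)
    dominating⇒pair₁-IDF u≢v dom x fx≡v0 =
      inj₂ (u , v , u≢v , proj₁ (dom x x≢u x≢v) , proj₂ (dom x x≢u x≢v) , pair₁-at₁ , pair₁-at₂)
      where
      x≢u : x ≢ u
      x≢u refl = ≡v1⇒≢v0 pair₁-at₁ fx≡v0
      x≢v : x ≢ v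
      x≢v refl = ≡v1⇒≢v0 pair₁-at₂ fx≡v0

module _ {n} (D : Digraph n) (2≤n : 2 ≤ n) where

  IDF-of-weight-2⇒γI≡2 : ∀ {f} → IsIDF D f → weight f ≡ 2 → γI≡ D 2
  IDF-of-weight-2⇒γI≡2 idf weight≡2 = (_ , idf , weight≡2) , λ g idg → 2≤weight D idg 2≤n

  dominating-vertex⇒γI≡2 : DominatingVertex D → γI≡ D 2
  dominating-vertex⇒γI≡2 (u , dom) =
    IDF-of-weight-2⇒γI≡2 (dominating⇒point₂-IDF D dom) (weight-point₂ {u = u})

  dominating-pair⇒γI≡2 : DominatingPair D → γI≡ D 2
  dominating-pair⇒γI≡2 (u , v , u≢v , dom) =
    IDF-of-weight-2⇒γI≡2 (dominating⇒pair₁-IDF D u≢v dom) (weight-pair₁ u≢v)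

theorem2p4 : (n : ℕ) → 3 ≤ n → (D : Digraph n) →
    γI≡ D 2 ⇔
      (Δ⁺ D ≡ n ∸ 1
       ⊎ Σ (Fin n) λ u → Σ (Fin n) λ v → u ≢ v ×
           (∀ w → w ≢ u → w ≢ v → Arc D u w × Arc D v w))
theorem2p4 n 3≤n D = mk⇔
  (λ ((_ , idf , weight≡2) , _) →
     Sum.map₁ (from (Δ⁺≡n∸1⇔ D 2≤n)) (weight≡2⇒dominating D idf 3≤n weight≡2))
  [ dominating-vertex⇒γI≡2 D 2≤n ∘ to (Δ⁺≡n∸1⇔ D 2≤n) , dominating-pair⇒γI≡2 D 2≤n ]′
  where
  2≤n : 2 ≤ n
  2≤n = ≤-trans (n≤1+n 2) 3≤n
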